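{- Let $G$ be a connected graph of order $n$ with maximum degree $\Delta$, and let $k\ge\chi(G)$ be an integer. Then $\mathrm{sn}(G,k)=n$ if and only if $k>\Delta+1$. Also $\underline{\mathrm{lcs}}(G,k)=n$ if and only if $k>\Delta+1$.
   Context: For a graph $G=(V,E)$ and an integer $k\ge\chi(G)$, a proper $k$-colouring is a map $c\colon V\to\{1,\dots,k\}$ with adjacent vertices receiving different colours. A determining set for $(G,c)$ is a set $S\subseteq V$ such that there is no proper $k$-colouring $c'\neq c$ of $G$ with $c'(s)=c(s)$ for all $s\in S$. A critical set for $(G,c)$ is an inclusion-minimal determining set. $\mathrm{scs}(G,c)$ and $\mathrm{lcs}(G,c)$ denote the minimum and maximum size of a critical set for $(G,c)$. $\mathrm{sn}(G,k)$ is the minimum of $\mathrm{scs}(G,c)$ and $\underline{\mathrm{lcs}}(G,k)$ is the minimum of $\mathrm{lcs}(G,c)$, both over all proper $k$-colourings $c$ of $G$. -}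

module Defs where

open import Data.Nat using (ℕ; zero; suc; _+_; _≤_; _<_; _⊔_)
open import Data.Fin using (Fin)
open import Data.Fin.Subset using (Subset; _∈_; _⊂_; ∣_∣)
open import Data.Bool using (Bool; true; false; if_then_else_)
open import Data.List using (List; map; foldr; allFin)
open import Data.Nat.ListAction using (sum)
open import Data.Product using (Σ; ∃; _×_; _,_)
open import Relation.Binary.PropositionalEquality using (_≡_; _≢_)
open import Relation.Nullary using (¬_)

record Graph (n : ℕ) : Set where
  field
    adj   : Fin n → Fin n → Bool
    sym   : ∀ u v → adj u v ≡ adj v u
    irrefl : ∀ v → adj v v ≡ false
open Graph public

module _ {n : ℕ} (G : Graph n) where

  data Walk : Fin n → Fin n → Set where
    here : ∀ {v} → Walk v v
    step : ∀ {u w v} → adj G u w ≡ true → Walk w v → Walk u v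

  Connected : Set
  Connected = (1 ≤ n) × (∀ u v → Walk u v)

  degree : Fin n → ℕ
  degree v = sum (map (λ w → if adj G v w then 1 else 0) (allFin n))

  -- maximum degree Δ(G) (0 for the empty graph)
  maxDegree : ℕ
  maxDegree = foldr _⊔_ 0 (map degree (allFin n))

  Colouring : ℕ → Set
  Colouring k = Fin n → Fin k

  Proper : ∀ {k} → Colouring k → Set
  Proper c = ∀ u v → adj G u v ≡ true → c u ≢ c v

  IsChromaticNumber : ℕ → Set
  IsChromaticNumber m = (Σ (Colouring m) Proper) × (∀ j → Σ (Colouring j) Proper → m ≤ j)

  module _ {k : ℕ} (c : Colouring k) where

    Determining : Subset n → Set
    Determining S = ∀ (c' : Colouring k) → Proper c' →
                    (∀ s → s ∈ S → c' s ≡ c s) → ∀ v → c' v ≡ c v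

    Critical : Subset n → Set
    Critical S = Determining S × (∀ T → T ⊂ S → ¬ Determining T)

    IsScs : ℕ → Set
    IsScs m = (∃ λ S → Critical S × ∣ S ∣ ≡ m) × (∀ S → Critical S → m ≤ ∣ S ∣)

    IsLcs : ℕ → Set
    IsLcs m = (∃ λ S → Critical S × ∣ S ∣ ≡ m) × (∀ S → Critical S → ∣ S ∣ ≤ m)

  IsSn : ℕ → ℕ → Set
  IsSn k m = (∃ λ (c : Colouring k) → Proper c × IsScs c m)
           × (∀ (c : Colouring k) → Proper c → ∀ m' → IsScs c m' → m ≤ m')

  IsLcsMin : ℕ → ℕ → Set
  IsLcsMin k m = (∃ λ (c : Colouring k) → Proper c × IsLcs c m)
               × (∀ (c : Colouring k) → Proper c → ∀ m' → IsLcs c m' → m ≤ m')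

-- A vertex x is forced in a colouring c when its neighbours carry every colour other than c x;
-- this needs k − 1 ≤ deg x. An unforced vertex lies in every determining set, since otherwise it
-- could be recoloured, so if no proper k-colouring has a forced vertex (e.g. when k > Δ + 1) the
-- whole vertex set is the only critical set and sn = lcs = n. If some proper k-colouring has a
-- forced vertex x, then V − x is determining and every critical set of that colouring has fewer
-- than n vertices, so neither sn nor lcs equals n.
-- It remains to find a forced vertex when k ≤ Δ + 1. Suppose there is none and let v have degree
-- Δ ≥ k − 1. Then v misses some colour a ≠ c v, so two neighbours u, u′ of v share a colour. Each
-- neighbour of u coloured a is unforced, hence can be recoloured away from a; afterwards u takes
-- colour a, and v sees strictly more colours than before. This cannot go on forever.
-- Determining sets are not decidable here, so smallest and largest critical sets are only
-- obtained under double negation; that suffices, as they are only used to reach a contradiction.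

module Submission where

open import Defs hiding (sym)
open import Data.Bool using (Bool; true; false; if_then_else_)
import Data.Bool.Properties as Bool
open import Data.Fin using (Fin; zero; suc; _≟_; inject≤; fromℕ<)
open import Data.Fin.Properties using (any?; ¬∀⟶∃¬; suc-injective; inject≤-injective)
open import Data.Fin.Subset using (Subset; _∈_; _⊆_; _⊂_; ∣_∣; ⊤; ∁; ⁅_⁆; _-_; inside; outside)
open import Data.Fin.Subset.Properties
  using ( _∈?_; ∈⊤; x∈∁p⇒x∉p; x∉p⇒x∈∁p; x≢y⇒x∉⁅y⁆; x∉⁅y⁆⇒x≢y; x∈p∧x≢y⇒x∈p-y; ⊆-antisym
        ; ∣⊤∣≡n; ∣∁p∣≡n∸∣p∣; ∣⁅x⁆∣≡1; ∣p∣≤n; ∣p∣≡n⇒p≡⊤; x∈p⇒∣p-x∣<∣p∣; x∈p⇒p-x⊂p; p⊂q⇒∣p∣<∣q∣)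
open import Data.List using (allFin; tabulate) renaming (map to mapᴸ)
open import Data.List.Properties using (map-tabulate; foldr-forcesᵇ)
open import Data.List.Membership.Propositional.Properties using (∈-map⁺; ∈-map⁻; ∈-allFin; foldr-selective)
open import Data.List.Relation.Unary.All as All using (All)
open import Data.Nat using (ℕ; zero; suc; _+_; _∸_; _≤_; _<_; z≤n; s≤s; s≤s⁻¹)
open import Data.Nat.Properties
  using ( module ≤-Reasoning; ≤-refl; ≤-trans; ≤-reflexive; ≮⇒≥; ≰⇒>; <⇒≱; ≤∧≢⇒<; ≤-<-trans; <-≤-trans
        ; +-comm; m≤n+m∸n; m≤n+o⇒m∸n≤o; ∸-cancelʳ-≤; ⊔-sel; m⊔n≤o⇒m≤o; m⊔n≤o⇒n≤o)
open import Data.Nat.Induction using (<-wellFounded)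
open import Data.Nat.ListAction using (sum)
open import Data.Product using (Σ; ∃; ∃₂; _×_; _,_; proj₁; proj₂)
open import Data.Sum using (inj₁; inj₂)
open import Data.Vec using (_∷_; []; here; there)
open import Data.Vec.Functional using (updateAt)
open import Data.Vec.Functional.Properties using (updateAt-updates; updateAt-minimal)
open import Function using (_∘_; id; const)
open import Function.Bundles using (_⇔_; mk⇔)
open import Function.Construct.Composition using (_⇔-∘_)
open import Induction.WellFounded using (Acc; acc)
open import Level using (0ℓ)
open import Relation.Binary.PropositionalEquality using (_≡_; _≢_; refl; sym; trans; cong; subst)
open import Relation.Nullary using (¬_; Dec; yes; no; does; ¬?; _×-dec_; _→-dec_)
open import Relation.Nullary.Decidable.Core using (¬¬-excluded-middle)
open import Relation.Nullary.Negation using (contradiction)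
open import Relation.Unary using (Pred; Decidable)

¬¬-argmin : {A : Set} (μ : A → ℕ) (P : A → Set) {a : A} → P a →
            ¬ ¬ (∃ λ x → P x × ∀ y → P y → μ x ≤ μ y)
¬¬-argmin {A} μ P {a} pa = go a (<-wellFounded (μ a)) pa
  where
  go : ∀ x → Acc _<_ (μ x) → P x → ¬ ¬ (∃ λ x → P x × ∀ y → P y → μ x ≤ μ y)
  go x (acc rs) px noArgmin = ¬¬-excluded-middle smaller-or-not
    where
    smaller-or-not : ¬ Dec (∃ λ y → P y × μ y < μ x)
    smaller-or-not (yes (y , py , μy<μx)) = go y (rs μy<μx) py noArgmin
    smaller-or-not (no noSmaller) =
      noArgmin (x , px , λ y py → ≮⇒≥ (λ μy<μx → noSmaller (y , py , μy<μx)))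

subsetOf : ∀ {n} {P : Pred (Fin n) 0ℓ} → Decidable P → Subset n
subsetOf {zero}  P? = []
subsetOf {suc n} P? = does (P? zero) ∷ subsetOf (P? ∘ suc)

∈-subsetOf⁺ : ∀ {n} {P : Pred (Fin n) 0ℓ} (P? : Decidable P) {x} → P x → x ∈ subsetOf P?
∈-subsetOf⁺ P? {zero} px with P? zero
... | yes _  = here
... | no ¬px = contradiction px ¬px
∈-subsetOf⁺ P? {suc x} px = there (∈-subsetOf⁺ (P? ∘ suc) px)

∈-subsetOf⁻ : ∀ {n} {P : Pred (Fin n) 0ℓ} (P? : Decidable P) {x} → x ∈ subsetOf P? → P x
∈-subsetOf⁻ P? {zero} x∈ with P? zero | x∈
... | yes px | _ = px
∈-subsetOf⁻ P? {suc x} (there x∈) = ∈-subsetOf⁻ (P? ∘ suc) x∈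

Collision : ∀ {m n} → (Fin m → Fin n) → Subset m → Set
Collision f p = ∃₂ λ x y → x ∈ p × y ∈ p × x ≢ y × f x ≡ f y

collision-∷ : ∀ {m n s} {p : Subset m} {f : Fin (suc m) → Fin n} →
              Collision (f ∘ suc) p → Collision f (s ∷ p)
collision-∷ (x , y , x∈p , y∈p , x≢y , fx≡fy) =
  suc x , suc y , there x∈p , there y∈p , x≢y ∘ suc-injective , fx≡fy

pigeonhole-⊆ : ∀ {m n} {p : Subset m} {q : Subset n} (f : Fin m → Fin n) →
               (∀ {x} → x ∈ p → f x ∈ q) → ∣ q ∣ < ∣ p ∣ → Collision f p
pigeonhole-⊆ {p = outside ∷ p} f maps q<p = collision-∷ (pigeonhole-⊆ (f ∘ suc) (maps ∘ there) q<p)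
pigeonhole-⊆ {p = inside ∷ p} {q} f maps q<p with any? (λ y → y ∈? p ×-dec f (suc y) ≟ f zero)
... | yes (y , y∈p , fy≡f0) = suc y , zero , there y∈p , here , (λ ()) , fy≡f0
... | no noCollision = collision-∷ (pigeonhole-⊆ (f ∘ suc) maps′ ∣q-f0∣<∣p∣)
  where
  maps′ : ∀ {x} → x ∈ p → f (suc x) ∈ q - f zero
  maps′ {x} x∈p = x∈p∧x≢y⇒x∈p-y (maps (there x∈p)) (λ eq → noCollision (x , x∈p , eq))
  ∣q-f0∣<∣p∣ : ∣ q - f zero ∣ < ∣ p ∣
  ∣q-f0∣<∣p∣ = <-≤-trans (x∈p⇒∣p-x∣<∣p∣ (maps here)) (s≤s⁻¹ q<p)

injective⇒∣p∣≤∣q∣ : ∀ {m n} {p : Subset m} {q : Subset n} (f : Fin m → Fin n) →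
                    (∀ {x} → x ∈ p → f x ∈ q) →
                    (∀ {x y} → x ∈ p → y ∈ p → f x ≡ f y → x ≡ y) → ∣ p ∣ ≤ ∣ q ∣
injective⇒∣p∣≤∣q∣ f maps inj = ≮⇒≥ λ q<p →
  let (x , y , x∈p , y∈p , x≢y , fx≡fy) = pigeonhole-⊆ f maps q<p in x≢y (inj x∈p y∈p fx≡fy)

∣∁⁅x⁆∣≡n∸1 : ∀ {n} (x : Fin n) → ∣ ∁ ⁅ x ⁆ ∣ ≡ n ∸ 1
∣∁⁅x⁆∣≡n∸1 {n} x = trans (∣∁p∣≡n∸∣p∣ ⁅ x ⁆) (cong (n ∸_) (∣⁅x⁆∣≡1 x))

∀∈⇒∣p∣≡n : ∀ {n} {p : Subset n} → (∀ x → x ∈ p) → ∣ p ∣ ≡ n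
∀∈⇒∣p∣≡n {n} {p} ∀∈ = trans (cong ∣_∣ (⊆-antisym (λ _ → ∈⊤) (λ {x} _ → ∀∈ x))) (∣⊤∣≡n n)

∣⊤-x∣<n : ∀ {n} (x : Fin n) → ∣ ⊤ - x ∣ < n
∣⊤-x∣<n {n} x = subst (∣ ⊤ - x ∣ <_) (∣⊤∣≡n n) (x∈p⇒∣p-x∣<∣p∣ (∈⊤ {x = x}))

sum-indicator≡∣subsetOf∣ : ∀ {m} (f : Fin m → Bool) →
  sum (tabulate (λ w → if f w then 1 else 0)) ≡ ∣ subsetOf (λ w → f w Bool.≟ true) ∣
sum-indicator≡∣subsetOf∣ {zero} f = refl
sum-indicator≡∣subsetOf∣ {suc m} f with f zero
... | true  = cong suc (sum-indicator≡∣subsetOf∣ (f ∘ suc))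
... | false = sum-indicator≡∣subsetOf∣ (f ∘ suc)

module _ {n : ℕ} (G : Graph n) where

  neighbours : Fin n → Subset n
  neighbours v = subsetOf (λ w → adj G v w Bool.≟ true)

  degree≡∣neighbours∣ : ∀ v → degree G v ≡ ∣ neighbours v ∣
  degree≡∣neighbours∣ v =
    trans (cong sum (map-tabulate id (λ w → if adj G v w then 1 else 0)))
          (sum-indicator≡∣subsetOf∣ (adj G v))

  degree≤maxDegree : ∀ v → degree G v ≤ maxDegree G
  degree≤maxDegree v = All.lookup all≤Δ (∈-map⁺ (degree G) (∈-allFin v))
    where
    all≤Δ : All (_≤ maxDegree G) (mapᴸ (degree G) (allFin n))
    all≤Δ = foldr-forcesᵇ (λ x y x⊔y≤Δ → m⊔n≤o⇒m≤o x y x⊔y≤Δ , m⊔n≤o⇒n≤o x y x⊔y≤Δ) 0 _ ≤-refl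

  maxDegree-attained : Fin n → ∃ λ v → maxDegree G ≤ degree G v
  maxDegree-attained v₀ with foldr-selective ⊔-sel 0 (mapᴸ (degree G) (allFin n))
  ... | inj₁ Δ≡0 = v₀ , ≤-trans (≤-reflexive Δ≡0) z≤n
  ... | inj₂ Δ∈degrees with ∈-map⁻ (degree G) Δ∈degrees
  ...   | v , _ , Δ≡degree = v , ≤-reflexive Δ≡degree

  adj-sym : ∀ {x y} → adj G x y ≡ true → adj G y x ≡ true
  adj-sym {x} {y} xy = trans (Graph.sym G y x) xy

  adj-irrefl : ∀ {x} → adj G x x ≢ true
  adj-irrefl {x} xx with () ← trans (sym xx) (irrefl G x)

  module _ {k : ℕ} where

    Seen : Colouring G k → Fin n → Fin k → Set
    Seen c x a = ∃ λ w → adj G x w ≡ true × c w ≡ a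

    seenVia? : ∀ (c : Colouring G k) x a → Decidable (λ w → adj G x w ≡ true × c w ≡ a)
    seenVia? c x a w = (adj G x w Bool.≟ true) ×-dec (c w ≟ a)

    seen? : ∀ (c : Colouring G k) x → Decidable (Seen c x)
    seen? c x a = any? (seenVia? c x a)

    Forced : Colouring G k → Fin n → Set
    Forced c x = ∀ a → a ≢ c x → Seen c x a

    free-colour : ∀ (c : Colouring G k) x → ¬ Forced c x → ∃ λ d → d ≢ c x × ¬ Seen c x d
    free-colour c x unforced
      with ¬∀⟶∃¬ k _ (λ a → ¬? (a ≟ c x) →-dec seen? c x a) unforced
    ... | a , ¬[a≢cx⇒seen] with a ≟ c x
    ...   | yes a≡cx = contradiction (λ a≢cx → contradiction a≡cx a≢cx) ¬[a≢cx⇒seen]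
    ...   | no a≢cx  = a , a≢cx , λ seen → ¬[a≢cx⇒seen] (λ _ → seen)

    forced⇒k≤1+degree : ∀ (c : Colouring G k) x → Forced c x → k ≤ suc (degree G x)
    forced⇒k≤1+degree c x forced = begin
      k                       ≤⟨ m≤n+m∸n k 1 ⟩
      suc (k ∸ 1)             ≡⟨ cong suc (sym (∣∁⁅x⁆∣≡n∸1 (c x))) ⟩
      suc ∣ ∁ ⁅ c x ⁆ ∣       ≤⟨ s≤s (injective⇒∣p∣≤∣q∣ witness witness∈N witness-injective) ⟩
      suc ∣ neighbours x ∣    ≡⟨ cong suc (sym (degree≡∣neighbours∣ x)) ⟩
      suc (degree G x)        ∎
      where
      open ≤-Reasoning
      ≢cx : ∀ {a} → a ∈ ∁ ⁅ c x ⁆ → a ≢ c x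
      ≢cx = x∉⁅y⁆⇒x≢y ∘ x∈∁p⇒x∉p
      witness : Fin k → Fin n
      witness a with a ≟ c x
      ... | yes _    = x
      ... | no a≢cx = proj₁ (forced a a≢cx)
      witness-sees : ∀ a → a ≢ c x → adj G x (witness a) ≡ true × c (witness a) ≡ a
      witness-sees a a≢cx with a ≟ c x
      ... | yes a≡cx = contradiction a≡cx a≢cx
      ... | no a≢cx = proj₂ (forced a a≢cx)
      witness∈N : ∀ {a} → a ∈ ∁ ⁅ c x ⁆ → witness a ∈ neighbours x
      witness∈N {a} a∈ = ∈-subsetOf⁺ _ (proj₁ (witness-sees a (≢cx a∈)))
      witness-injective : ∀ {a b} → a ∈ ∁ ⁅ c x ⁆ → b ∈ ∁ ⁅ c x ⁆ → witness a ≡ witness b → a ≡ b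
      witness-injective {a} {b} a∈ b∈ eq =
        trans (sym (proj₂ (witness-sees a (≢cx a∈)))) (trans (cong c eq) (proj₂ (witness-sees b (≢cx b∈))))

    recolour : Colouring G k → Fin n → Fin k → Colouring G k
    recolour c x d = updateAt c x (const d)

    recolour-here : ∀ (c : Colouring G k) x d → recolour c x d x ≡ d
    recolour-here c x d = updateAt-updates x c

    recolour-there : ∀ (c : Colouring G k) {x} d {y} → y ≢ x → recolour c x d y ≡ c y
    recolour-there c {x} d {y} y≢x = updateAt-minimal y x c y≢x

    recolour-proper : ∀ {c : Colouring G k} {x d} → Proper G c → ¬ Seen c x d → Proper G (recolour c x d)
    recolour-proper {c} {x} {d} c-proper d-unseen u v uv with u ≟ x | v ≟ x
    ... | yes refl | yes refl = contradiction uv adj-irrefl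
    ... | yes refl | no v≢x   = λ eq →
      d-unseen (v , uv , trans (sym (recolour-there c d v≢x)) (trans (sym eq) (recolour-here c x d)))
    ... | no u≢x   | yes refl = λ eq →
      d-unseen (u , adj-sym uv , trans (sym (recolour-there c d u≢x)) (trans eq (recolour-here c x d)))
    ... | no u≢x   | no v≢x   = λ eq →
      c-proper u v uv (trans (sym (recolour-there c d u≢x)) (trans eq (recolour-there c d v≢x)))

    forced⇒determining : ∀ {c : Colouring G k} {x} → Forced c x → Determining G c (⊤ - x)
    forced⇒determining {c} {x} forced c′ c′-proper agree v with v ≟ x
    ... | no v≢x = agree v (x∈p∧x≢y⇒x∈p-y ∈⊤ v≢x)
    ... | yes refl with c′ v ≟ c v
    ...   | yes c′v≡cv = c′v≡cv
    ...   | no c′v≢cv with forced (c′ v) c′v≢cv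
    ...     | w , vw , cw≡c′v = contradiction (trans (sym cw≡c′v) (sym (agree w w∈⊤-v))) (c′-proper v w vw)
      where
      w∈⊤-v : w ∈ ⊤ - v
      w∈⊤-v = x∈p∧x≢y⇒x∈p-y ∈⊤ λ { refl → adj-irrefl vw }

    unforced∈determining : ∀ {c : Colouring G k} {x S} → Proper G c → ¬ Forced c x →
                           Determining G c S → x ∈ S
    unforced∈determining {c} {x} {S} c-proper unforced determining with x ∈? S
    ... | yes x∈S = x∈S
    ... | no x∉S with free-colour c x unforced
    ...   | d , d≢cx , d-unseen = contradiction (trans (sym (recolour-here c x d)) c′x≡cx) d≢cx
      where
      c′x≡cx : recolour c x d x ≡ c x
      c′x≡cx = determining (recolour c x d) (recolour-proper c-proper d-unseen)
                 (λ s s∈S → recolour-there c d λ { refl → x∉S s∈S }) x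

  NoForcedVertex : ℕ → Set
  NoForcedVertex k = ∀ (c : Colouring G k) → Proper G c → ∀ x → ¬ Forced c x

  module _ {k : ℕ} where

    module _ (noForced : NoForcedVertex k) {c : Colouring G k} (c-proper : Proper G c) where

      ⊤-critical : Critical G c ⊤
      ⊤-critical = (λ _ _ agree v → agree v ∈⊤) ,
        λ { T (_ , x , _ , x∉T) T-determining →
              x∉T (unforced∈determining c-proper (noForced c c-proper x) T-determining) }

      critical⇒∣S∣≡n : ∀ {S} → Critical G c S → ∣ S ∣ ≡ n
      critical⇒∣S∣≡n (S-determining , _) =
        ∀∈⇒∣p∣≡n λ x → unforced∈determining c-proper (noForced c c-proper x) S-determining

      noForced⇒isScs : IsScs G c n
      noForced⇒isScs = (⊤ , ⊤-critical , ∣⊤∣≡n n) ,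
        λ S S-critical → ≤-reflexive (sym (critical⇒∣S∣≡n S-critical))

      noForced⇒isLcs : IsLcs G c n
      noForced⇒isLcs = (⊤ , ⊤-critical , ∣⊤∣≡n n) ,
        λ S S-critical → ≤-reflexive (critical⇒∣S∣≡n S-critical)

    noForced⇒isSn : NoForcedVertex k → Σ (Colouring G k) (Proper G) → IsSn G k n
    noForced⇒isSn noForced (c₀ , c₀-proper) =
      (c₀ , c₀-proper , noForced⇒isScs noForced c₀-proper) ,
      λ c c-proper m ((S , S-critical , ∣S∣≡m) , _) →
        ≤-reflexive (trans (sym (critical⇒∣S∣≡n noForced c-proper S-critical)) ∣S∣≡m)

    noForced⇒isLcsMin : NoForcedVertex k → Σ (Colouring G k) (Proper G) → IsLcsMin G k n
    noForced⇒isLcsMin noForced (c₀ , c₀-proper) =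
      (c₀ , c₀-proper , noForced⇒isLcs noForced c₀-proper) ,
      λ c c-proper m ((S , S-critical , ∣S∣≡m) , _) →
        ≤-reflexive (trans (sym (critical⇒∣S∣≡n noForced c-proper S-critical)) ∣S∣≡m)

    module _ {c : Colouring G k} where

      smallest-determining⇒isScs : ∀ {S} → Determining G c S →
                                   (∀ U → Determining G c U → ∣ S ∣ ≤ ∣ U ∣) → IsScs G c ∣ S ∣
      smallest-determining⇒isScs {S} S-determining smallest =
        (S , S-critical , refl) , λ U U-critical → smallest U (proj₁ U-critical)
        where
        S-critical : Critical G c S
        S-critical = S-determining , λ T T⊂S T-determining →
          <⇒≱ (p⊂q⇒∣p∣<∣q∣ T⊂S) (smallest T T-determining)

      module _ {x} (forced : Forced c x) where

        forced⇒¬¬isScs<n : ¬ ¬ (∃ λ m → IsScs G c m × m < n)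
        forced⇒¬¬isScs<n noSmallScs = ¬¬-argmin ∣_∣ (Determining G c) (forced⇒determining forced)
          λ (S , S-determining , smallest) → noSmallScs
            (∣ S ∣ , smallest-determining⇒isScs S-determining smallest ,
             ≤-<-trans (smallest (⊤ - x) (forced⇒determining forced)) (∣⊤-x∣<n x))

        forced⇒critical⇒∣S∣<n : ∀ {S} → Critical G c S → ∣ S ∣ < n
        forced⇒critical⇒∣S∣<n {S} (_ , minimal) = ≤∧≢⇒< (∣p∣≤n S) λ ∣S∣≡n →
          minimal (⊤ - x) (subst (⊤ - x ⊂_) (sym (∣p∣≡n⇒p≡⊤ ∣S∣≡n)) (x∈p⇒p-x⊂p {p = ⊤} ∈⊤))
                  (forced⇒determining forced)

        forced⇒¬¬isLcs<n : ¬ ¬ (∃ λ m → IsLcs G c m × m < n)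
        forced⇒¬¬isLcs<n noSmallLcs = forced⇒¬¬isScs<n λ (_ , ((S , S-critical , _) , _) , _) →
          ¬¬-argmin (λ T → n ∸ ∣ T ∣) (Critical G c) S-critical
            λ (T , T-critical , largest) → noSmallLcs
              (∣ T ∣ ,
               ((T , T-critical , refl) , λ U U-critical → ∸-cancelʳ-≤ (∣p∣≤n U) (largest U U-critical)) ,
               forced⇒critical⇒∣S∣<n T-critical)

    isSn⇒noForced : IsSn G k n → NoForcedVertex k
    isSn⇒noForced (_ , least) c c-proper x forced =
      forced⇒¬¬isScs<n forced λ (m , isScs , m<n) → <⇒≱ m<n (least c c-proper m isScs)

    isLcsMin⇒noForced : IsLcsMin G k n → NoForcedVertex k
    isLcsMin⇒noForced (_ , least) c c-proper x forced =
      forced⇒¬¬isLcs<n forced λ (m , isLcs , m<n) → <⇒≱ m<n (least c c-proper m isLcs)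

    repeated-colour : ∀ {c : Colouring G k} {v a} → Proper G c → k ≤ suc (degree G v) →
                      a ≢ c v → ¬ Seen c v a → Collision c (neighbours v)
    repeated-colour {c} {v} {a} c-proper k≤1+deg a≢cv a-unseen =
      pigeonhole-⊆ c avoids-a-and-cv (begin-strict
        ∣ ∁ ⁅ a ⁆ - c v ∣     <⟨ x∈p⇒∣p-x∣<∣p∣ (x∉p⇒x∈∁p (x≢y⇒x∉⁅y⁆ (a≢cv ∘ sym))) ⟩
        ∣ ∁ ⁅ a ⁆ ∣           ≡⟨ ∣∁⁅x⁆∣≡n∸1 a ⟩
        k ∸ 1                 ≤⟨ m≤n+o⇒m∸n≤o k 1 k≤1+deg ⟩
        degree G v            ≡⟨ degree≡∣neighbours∣ v ⟩
        ∣ neighbours v ∣      ∎)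
      where
      open ≤-Reasoning
      avoids-a-and-cv : ∀ {w} → w ∈ neighbours v → c w ∈ ∁ ⁅ a ⁆ - c v
      avoids-a-and-cv {w} w∈N = x∈p∧x≢y⇒x∈p-y
        (x∉p⇒x∈∁p (x≢y⇒x∉⁅y⁆ λ cw≡a → a-unseen (w , vw , cw≡a)))
        (c-proper v w vw ∘ sym)
        where
        vw : adj G v w ≡ true
        vw = ∈-subsetOf⁻ _ w∈N

    module _ (noForced : NoForcedVertex k) where

      colouredNeighbours : Colouring G k → Fin n → Fin k → Subset n
      colouredNeighbours c u a = subsetOf (seenVia? c u a)

      clear-colour : ∀ {c : Colouring G k} → Proper G c → ∀ u a →
                     ∃ λ c′ → Proper G c′ × (∀ y → c y ≢ a → c′ y ≡ c y) × ¬ Seen c′ u a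
      clear-colour {c₀} c₀-proper u a = go c₀ (<-wellFounded _) c₀-proper
        where
        Cleared : Colouring G k → Set
        Cleared c = ∃ λ c′ → Proper G c′ × (∀ y → c y ≢ a → c′ y ≡ c y) × ¬ Seen c′ u a
        go : ∀ c → Acc _<_ ∣ colouredNeighbours c u a ∣ → Proper G c → Cleared c
        go c (acc rs) c-proper with seen? c u a
        ... | no a-unseen = c , c-proper , (λ _ _ → refl) , a-unseen
        ... | yes (x , ux , cx≡a) with free-colour c x (noForced c c-proper x)
        ...   | d , d≢cx , d-unseen = lift (go c₁ (rs fewer) (recolour-proper c-proper d-unseen))
          where
          c₁ : Colouring G k
          c₁ = recolour c x d
          c₁x≢a : c₁ x ≢ a
          c₁x≢a c₁x≡a = d≢cx (trans (sym (recolour-here c x d)) (trans c₁x≡a (sym cx≡a)))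
          fewer : ∣ colouredNeighbours c₁ u a ∣ < ∣ colouredNeighbours c u a ∣
          fewer = p⊂q⇒∣p∣<∣q∣ (shrinks , x , ∈-subsetOf⁺ _ (ux , cx≡a) , c₁x≢a ∘ proj₂ ∘ ∈-subsetOf⁻ _)
            where
            shrinks : colouredNeighbours c₁ u a ⊆ colouredNeighbours c u a
            shrinks {w} w∈ with ∈-subsetOf⁻ _ w∈
            ... | uw , c₁w≡a = ∈-subsetOf⁺ _ (uw , trans (sym (recolour-there c d w≢x)) c₁w≡a)
              where
              w≢x : w ≢ x
              w≢x refl = c₁x≢a c₁w≡a
          lift : Cleared c₁ → Cleared c
          lift (c′ , c′-proper , agree , a-unseen) = c′ , c′-proper , agree′ , a-unseen
            where
            agree′ : ∀ y → c y ≢ a → c′ y ≡ c y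
            agree′ y cy≢a = trans (agree y (cy≢a ∘ trans (sym c₁y≡cy))) c₁y≡cy
              where
              c₁y≡cy : c₁ y ≡ c y
              c₁y≡cy = recolour-there c d λ { refl → cy≢a cx≡a }

      unseenColours : Colouring G k → Fin n → Subset k
      unseenColours c v = subsetOf (λ a → ¬? (seen? c v a))

      noForced⇒1+degree<k : ∀ {c : Colouring G k} → Proper G c → ∀ v → suc (degree G v) < k
      noForced⇒1+degree<k {c₀} c₀-proper v = ≰⇒> (go c₀ (<-wellFounded _) c₀-proper)
        where
        go : ∀ c → Acc _<_ ∣ unseenColours c v ∣ → Proper G c → ¬ k ≤ suc (degree G v)
        go c (acc rs) c-proper k≤1+deg with free-colour c v (noForced c c-proper v)
        ... | a , a≢cv , a-unseen with repeated-colour c-proper k≤1+deg a≢cv a-unseen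
        ...   | u , u′ , u∈N , u′∈N , u≢u′ , cu≡cu′ with clear-colour c-proper u a
        ...     | c′ , c′-proper , agree , a-unseen-at-u =
          go c″ (rs fewer) (recolour-proper c′-proper a-unseen-at-u) k≤1+deg
          where
          c″ : Colouring G k
          c″ = recolour c′ u a
          kept : ∀ {w} → w ≢ u → adj G v w ≡ true → c″ w ≡ c w
          kept {w} w≢u vw = trans (recolour-there c′ a w≢u) (agree w λ cw≡a → a-unseen (w , vw , cw≡a))
          still-seen : ∀ {b} → Seen c v b → Seen c″ v b
          still-seen {b} (w , vw , cw≡b) with w ≟ u
          ... | no w≢u = w , vw , trans (kept w≢u vw) cw≡b
          ... | yes refl = u′ , ∈-subsetOf⁻ _ u′∈N ,
                trans (kept (u≢u′ ∘ sym) (∈-subsetOf⁻ _ u′∈N)) (trans (sym cu≡cu′) cw≡b)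
          fewer : ∣ unseenColours c″ v ∣ < ∣ unseenColours c v ∣
          fewer = p⊂q⇒∣p∣<∣q∣
            ( (λ b∈ → ∈-subsetOf⁺ _ (∈-subsetOf⁻ _ b∈ ∘ still-seen))
            , a , ∈-subsetOf⁺ _ a-unseen
            , λ a∈ → ∈-subsetOf⁻ _ a∈ (u , ∈-subsetOf⁻ _ u∈N , recolour-here c′ u a))

    Δ+1<k⇒noForcedVertex : maxDegree G + 1 < k → NoForcedVertex k
    Δ+1<k⇒noForcedVertex Δ+1<k c _ x forced = <⇒≱ Δ+1<k (begin
      k                   ≤⟨ forced⇒k≤1+degree c x forced ⟩
      suc (degree G x)    ≤⟨ s≤s (degree≤maxDegree x) ⟩
      suc (maxDegree G)   ≡⟨ +-comm 1 (maxDegree G) ⟩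
      maxDegree G + 1     ∎)
      where open ≤-Reasoning

    noForced⇔Δ+1<k : Fin n → Σ (Colouring G k) (Proper G) → NoForcedVertex k ⇔ maxDegree G + 1 < k
    noForced⇔Δ+1<k v₀ (c , c-proper) = mk⇔ noForced⇒Δ+1<k Δ+1<k⇒noForcedVertex
      where
      noForced⇒Δ+1<k : NoForcedVertex k → maxDegree G + 1 < k
      noForced⇒Δ+1<k noForced with maxDegree-attained v₀
      ... | v , Δ≤degree = ≤-<-trans (≤-trans (≤-reflexive (+-comm (maxDegree G) 1)) (s≤s Δ≤degree))
                                     (noForced⇒1+degree<k noForced c-proper v)

    isSn⇔noForced : Σ (Colouring G k) (Proper G) → IsSn G k n ⇔ NoForcedVertex k
    isSn⇔noForced colouring = mk⇔ isSn⇒noForced λ noForced → noForced⇒isSn noForced colouring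

    isLcsMin⇔noForced : Σ (Colouring G k) (Proper G) → IsLcsMin G k n ⇔ NoForcedVertex k
    isLcsMin⇔noForced colouring = mk⇔ isLcsMin⇒noForced λ noForced → noForced⇒isLcsMin noForced colouring

  proper-inject≤ : ∀ {χ k} → χ ≤ k → Σ (Colouring G χ) (Proper G) → Σ (Colouring G k) (Proper G)
  proper-inject≤ χ≤k (c , c-proper) =
    (λ v → inject≤ (c v) χ≤k) , λ u v uv eq → c-proper u v uv (inject≤-injective χ≤k χ≤k _ _ eq)

mainTheorem3 : (n : ℕ) (G : Graph n) → Connected G →
               (k χ : ℕ) → IsChromaticNumber G χ → χ ≤ k →
               (IsSn G k n ⇔ maxDegree G + 1 < k) × (IsLcsMin G k n ⇔ maxDegree G + 1 < k)
mainTheorem3 n G (1≤n , _) k χ (χ-colouring , _) χ≤k =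
  noForced⇔Δ+1<k G (fromℕ< 1≤n) colouring ⇔-∘ isSn⇔noForced G colouring ,
  noForced⇔Δ+1<k G (fromℕ< 1≤n) colouring ⇔-∘ isLcsMin⇔noForced G colouring
  where
  colouring : Σ (Colouring G k) (Proper G)
  colouring = proper-inject≤ G χ≤k χ-colouring
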